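{- For $n\ge1$ let $y_n$ be the number of rows with value $0$ in the truth tables of all bracketed m-implications with $n$ distinct variables, and let $C_n=\frac1n\binom{2n-2}{n-1}$. Then for every $n\ge1$, $y_n\equiv C_n \pmod 2$.
   Context: Truth values are $1$ (true), $0$ (false). The connective $\rightharpoonup$ satisfies $\nu(\phi\rightharpoonup\psi)=0$ iff $\nu(\phi)=\nu(\psi)=1$, and $=1$ otherwise. A bracketed m-implication with $n$ variables is a well-formed formula obtained from $p_1\rightharpoonup\cdots\rightharpoonup p_n$ ($p_i$ distinct variables, in this order) by inserting brackets. $y_n$ is the total, over all such formulae $\phi$, of the number of valuations $\nu$ of $p_1,\dots,p_n$ with $\nu(\phi)=0$. (The paper phrases the conclusion as "the sequence $y_n$ preserves the parity of $C_n$", and in particular $y_n$ is odd iff $n$ is a power of $2$.) -}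

module Defs where

open import Data.Nat using (ℕ; zero; suc; _+_; _*_; _∸_; _/_; _≡ᵇ_)
open import Data.Nat.Combinatorics using (_C_)
open import Data.Bool using (Bool; true; false; _∧_; not; if_then_else_)
open import Data.List using (List; []; _∷_; _++_; map; concatMap; length; filter)
open import Data.Nat.ListAction using (sum)
open import Data.Vec using (Vec; []; _∷_; splitAt)
open import Data.Product using (Σ; _,_; proj₁; proj₂)
open import Relation.Binary.PropositionalEquality using (refl)
open import Relation.Nullary using (yes; no)
open import Data.Bool using (T?)
open import Data.Nat using (_≟_; NonZero)

-- m-implication: value 0 (false) iff both arguments are 1 (true)
_⇀_ : Bool → Bool → Bool
a ⇀ b = not (a ∧ b)

-- Bracketings of p₁ ⇀ ⋯ ⇀ pₙ : full binary trees whose n leaves are the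
-- variables p₁,…,pₙ in this order.
data Br : ℕ → Set where
  var  : Br 1
  impl : ∀ {m k} → Br (suc m) → Br (suc k) → Br (suc m + suc k)

eval : ∀ {n} → Br n → Vec Bool n → Bool
eval var (b ∷ []) = b
eval (impl {m} l r) v with splitAt (suc m) v
... | (xs , ys , refl) = eval l xs ⇀ eval r ys

vals : (n : ℕ) → List (Vec Bool n)
vals zero = [] ∷ []
vals (suc n) = map (true ∷_) (vals n) ++ map (false ∷_) (vals n)

zeros : ∀ {n} → Br n → ℕ
zeros {n} φ = length (filter (λ v → T? (not (eval φ v))) (vals n))

-- all bracketed formulas of depth ≤ d (each exactly once), with their size
depthUpTo : ℕ → List (Σ ℕ Br)
depthUpTo zero = (1 , var) ∷ []
depthUpTo (suc d) = (1 , var) ∷ concatMap pairs (depthUpTo d)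
  where
  pairs : Σ ℕ Br → List (Σ ℕ Br)
  pairs (zero , ())
  pairs (suc m , l) = concatMap (λ { (zero , ()) ; (suc k , r) → (suc m + suc k , impl l r) ∷ [] }) (depthUpTo d)

-- all bracketed m-implications with n variables (a tree with n leaves has depth ≤ n)
bracketings : (n : ℕ) → List (Br n)
bracketings n = concatMap pick (depthUpTo n)
  where
  pick : Σ ℕ Br → List (Br n)
  pick (k , t) with k ≟ n
  ... | yes refl = t ∷ []
  ... | no _ = []

y : ℕ → ℕ
y n = sum (map zeros (bracketings n))

catalan : (n : ℕ) → .{{_ : NonZero n}} → ℕ
catalan n = ((2 * n ∸ 2) C (n ∸ 1)) / n

-- Every bracketed m-implication φ is false at an odd number of valuations: the number of
-- zeros of l ⇀ r is the product of the numbers of ones of l and of r, and the ones and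
-- zeros of any formula add up to a power of two, hence have the same parity.  So y_n is congruent to the number
-- of bracketings.  Counting bracketings by their top-level split (l , r), the pairs
-- (l , r) and (r , l) cancel mod 2 and only the diagonal l = r survives, which gives
-- B(2n) ≡ B(n) and B(2n + 1) ≡ 0 for n ≥ 1.  The Catalan numbers obey the same parity
-- recursion, by C_{m+1} = binom(2m, m) − binom(2m, m+1) and Lucas' theorem modulo 2.
module Submission where

open import Defs
open import Data.Nat using (ℕ; suc; _%_)
open import Relation.Binary.PropositionalEquality using (_≡_)

open import Data.Bool.Base using (Bool; true; false; not; _∧_; if_then_else_; T)
open import Data.Bool using (T?)
open import Data.Bool.Properties using (not-involutive)
open import Data.List.Base using (List; []; _∷_; _++_; map; concatMap; length; filter)
open import Data.List.Properties using (length-++; map-++; filter-++)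
open import Data.Nat.Base using (zero; _+_; _*_; _∸_; _/_; _^_; _≤_; s≤s; parity)
open import Data.Nat.Properties as ℕₚ
  using (_≟_; +-comm; +-assoc; +-suc; +-identityʳ; *-comm; *-distribˡ-+; *-distribʳ-+; *-distribʳ-∸;
         *-zeroʳ; *-identityʳ; +-cancelˡ-≡; *-cancelˡ-≤; m≤m+n; m≤n+m; m+n∸n≡m; m∸n+n≡m;
         ≤-trans; n≤1+n)
open import Algebra.Properties.CommutativeSemigroup ℕₚ.+-commutativeSemigroup using (interchange)
open import Data.Nat.ListAction using (sum)
open import Data.Nat.ListAction.Properties using (sum-++)
open import Data.Nat.Combinatorics using (_C_; nCk+nC[k+1]≡[n+1]C[k+1]; nC1≡n; nCk≡nC[n∸k])
open import Data.Nat.DivMod using (m*n/n≡m)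
open import Data.Parity.Base as ℙ using (Parity; 0ℙ; 1ℙ)
open import Data.Parity.Properties as ℙₚ using (+-homo-+; *-homo-*; p+p≡0ℙ)
open import Data.Product.Base using (Σ; _,_; proj₁)
open import Data.Vec.Base using (Vec; []; _∷_; splitAt) renaming (_++_ to _++ᵥ_)
open import Relation.Nullary.Decidable using (Dec; does; yes; no; dec-true; dec-false)
open import Relation.Binary.PropositionalEquality
  using (refl; sym; trans; cong; cong₂; subst; module ≡-Reasoning)

open ≡-Reasoning

toℕ : Parity → ℕ
toℕ 0ℙ = 0
toℕ 1ℙ = 1

n%2≡toℕ[parity[n]] : ∀ n → n % 2 ≡ toℕ (parity n)
n%2≡toℕ[parity[n]] zero          = refl
n%2≡toℕ[parity[n]] (suc zero)    = refl
n%2≡toℕ[parity[n]] (suc (suc n)) = n%2≡toℕ[parity[n]] n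

x+y≡0ℙ⇒x≡y : ∀ {x y} → x ℙ.+ y ≡ 0ℙ → x ≡ y
x+y≡0ℙ⇒x≡y {x} {y} x+y≡0 = ℙₚ.+-cancelʳ-≡ y x y (trans x+y≡0 (sym (p+p≡0ℙ y)))

[x+y]+y≡x : ∀ x y → (x ℙ.+ y) ℙ.+ y ≡ x
[x+y]+y≡x x y = begin
  (x ℙ.+ y) ℙ.+ y ≡⟨ ℙₚ.+-assoc x y y ⟩
  x ℙ.+ (y ℙ.+ y) ≡⟨ cong (x ℙ.+_) (p+p≡0ℙ y) ⟩
  x ℙ.+ 0ℙ        ≡⟨ ℙₚ.+-identityʳ x ⟩
  x               ∎

parity[m+m]≡0ℙ : ∀ m → parity (m + m) ≡ 0ℙ
parity[m+m]≡0ℙ m = trans (+-homo-+ m m) (p+p≡0ℙ (parity m))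

parity[[a+b]+[b+c]] : ∀ a b c → parity ((a + b) + (b + c)) ≡ parity a ℙ.+ parity c
parity[[a+b]+[b+c]] a b c = begin
  parity ((a + b) + (b + c))            ≡⟨ cong (λ x → parity ((a + b) + x)) (+-comm b c) ⟩
  parity ((a + b) + (c + b))            ≡⟨ cong parity (interchange a b c b) ⟩
  parity ((a + c) + (b + b))            ≡⟨ +-homo-+ (a + c) (b + b) ⟩
  parity (a + c) ℙ.+ parity (b + b)     ≡⟨ cong (parity (a + c) ℙ.+_) (parity[m+m]≡0ℙ b) ⟩
  parity (a + c) ℙ.+ 0ℙ                 ≡⟨ ℙₚ.+-identityʳ (parity (a + c)) ⟩
  parity (a + c)                        ≡⟨ +-homo-+ a c ⟩
  parity a ℙ.+ parity c                 ∎

parity-∸ : ∀ {m n} → n ≤ m → parity (m ∸ n) ≡ parity m ℙ.+ parity n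
parity-∸ {m} {n} n≤m = begin
  parity (m ∸ n)                             ≡⟨ sym ([x+y]+y≡x (parity (m ∸ n)) (parity n)) ⟩
  (parity (m ∸ n) ℙ.+ parity n) ℙ.+ parity n ≡⟨ cong (ℙ._+ parity n) (sym (+-homo-+ (m ∸ n) n)) ⟩
  parity (m ∸ n + n) ℙ.+ parity n            ≡⟨ cong (λ k → parity k ℙ.+ parity n) (m∸n+n≡m n≤m) ⟩
  parity m ℙ.+ parity n                      ∎

private
  variable
    A B : Set

∑ : List A → (A → ℕ) → ℕ
∑ xs f = sum (map f xs)

∑-cong : ∀ xs {f g : A → ℕ} → (∀ x → f x ≡ g x) → ∑ xs f ≡ ∑ xs g
∑-cong []       f≗g = refl
∑-cong (x ∷ xs) f≗g = cong₂ _+_ (f≗g x) (∑-cong xs f≗g)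

∑-zero : ∀ (xs : List A) → ∑ xs (λ _ → 0) ≡ 0
∑-zero []       = refl
∑-zero (x ∷ xs) = ∑-zero xs

∑-+ : ∀ xs (f g : A → ℕ) → ∑ xs (λ x → f x + g x) ≡ ∑ xs f + ∑ xs g
∑-+ []       f g = refl
∑-+ (x ∷ xs) f g =
  trans (cong (f x + g x +_) (∑-+ xs f g)) (interchange (f x) (g x) (∑ xs f) (∑ xs g))

∑-++ : ∀ xs ys (f : A → ℕ) → ∑ (xs ++ ys) f ≡ ∑ xs f + ∑ ys f
∑-++ xs ys f = trans (cong sum (map-++ f xs ys)) (sum-++ (map f xs) (map f ys))

∑-concatMap : ∀ (g : A → List B) xs (f : B → ℕ) →
              ∑ (concatMap g xs) f ≡ ∑ xs (λ x → ∑ (g x) f)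
∑-concatMap g []       f = refl
∑-concatMap g (x ∷ xs) f =
  trans (∑-++ (g x) (concatMap g xs) f) (cong (∑ (g x) f +_) (∑-concatMap g xs f))

length-concatMap : ∀ (g : A → List B) xs →
                   length (concatMap g xs) ≡ ∑ xs (λ x → length (g x))
length-concatMap g []       = refl
length-concatMap g (x ∷ xs) =
  trans (length-++ (g x)) (cong (length (g x) +_) (length-concatMap g xs))

parity-∑-odd : ∀ xs (f : A → ℕ) → (∀ x → parity (f x) ≡ 1ℙ) → parity (∑ xs f) ≡ parity (length xs)
parity-∑-odd []       f odd = refl
parity-∑-odd (x ∷ xs) f odd = begin
  parity (f x + ∑ xs f)            ≡⟨ +-homo-+ (f x) (∑ xs f) ⟩
  parity (f x) ℙ.+ parity (∑ xs f) ≡⟨ cong₂ ℙ._+_ (odd x) (parity-∑-odd xs f odd) ⟩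
  1ℙ ℙ.+ parity (length xs)        ≡⟨ sym (+-homo-+ 1 (length xs)) ⟩
  parity (suc (length xs))         ∎

-- The off-diagonal terms H x y and H y x cancel in pairs.
parity-∑∑-symmetric : ∀ xs (H : A → A → ℕ) → (∀ x y → H x y ≡ H y x) →
                      parity (∑ xs (λ x → ∑ xs (H x))) ≡ parity (∑ xs (λ x → H x x))
parity-∑∑-symmetric []       H sym-H = refl
parity-∑∑-symmetric (x ∷ xs) H sym-H = begin
  parity ((H x x + ∑ xs (H x)) + ∑ xs (λ z → H z x + ∑ xs (H z)))
    ≡⟨ cong (λ s → parity ((H x x + ∑ xs (H x)) + s)) column≡row ⟩
  parity ((H x x + ∑ xs (H x)) + (∑ xs (H x) + ∑ xs (λ z → ∑ xs (H z))))
    ≡⟨ parity[[a+b]+[b+c]] (H x x) (∑ xs (H x)) (∑ xs (λ z → ∑ xs (H z))) ⟩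
  parity (H x x) ℙ.+ parity (∑ xs (λ z → ∑ xs (H z)))
    ≡⟨ cong (parity (H x x) ℙ.+_) (parity-∑∑-symmetric xs H sym-H) ⟩
  parity (H x x) ℙ.+ parity (∑ xs (λ z → H z z))
    ≡⟨ sym (+-homo-+ (H x x) (∑ xs (λ z → H z z))) ⟩
  parity (H x x + ∑ xs (λ z → H z z)) ∎
  where
  column≡row : ∑ xs (λ z → H z x + ∑ xs (H z)) ≡ ∑ xs (H x) + ∑ xs (λ z → ∑ xs (H z))
  column≡row = trans (∑-+ xs (λ z → H z x) (λ z → ∑ xs (H z)))
                     (cong (_+ ∑ xs (λ z → ∑ xs (H z))) (∑-cong xs (λ z → sym-H z x)))

-- Counting satisfying valuations

#sat : ∀ n → (Vec Bool n → Bool) → ℕ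
#sat zero    P = if P [] then 1 else 0
#sat (suc n) P = #sat n (λ v → P (true ∷ v)) + #sat n (λ v → P (false ∷ v))

#sat-cong : ∀ n {P Q : Vec Bool n → Bool} → (∀ v → P v ≡ Q v) → #sat n P ≡ #sat n Q
#sat-cong zero    P≗Q rewrite P≗Q [] = refl
#sat-cong (suc n) P≗Q =
  cong₂ _+_ (#sat-cong n (λ v → P≗Q (true ∷ v))) (#sat-cong n (λ v → P≗Q (false ∷ v)))

#sat-false : ∀ n → #sat n (λ _ → false) ≡ 0
#sat-false zero    = refl
#sat-false (suc n) = cong₂ _+_ (#sat-false n) (#sat-false n)

#sat-∧-++ : ∀ m n {R : Vec Bool (m + n) → Bool} (P : Vec Bool m → Bool) (Q : Vec Bool n → Bool) →
            (∀ xs ys → R (xs ++ᵥ ys) ≡ P xs ∧ Q ys) → #sat (m + n) R ≡ #sat m P * #sat n Q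
#sat-∧-++ zero n P Q R≗P∧Q = trans (#sat-cong n (R≗P∧Q [])) (constant∧Q (P []))
  where
  constant∧Q : ∀ b → #sat n (λ ys → b ∧ Q ys) ≡ (if b then 1 else 0) * #sat n Q
  constant∧Q true  = sym (+-identityʳ (#sat n Q))
  constant∧Q false = #sat-false n
#sat-∧-++ (suc m) n P Q R≗P∧Q = begin
  #sat (m + n) _ + #sat (m + n) _
    ≡⟨ cong₂ _+_ (#sat-∧-++ m n _ Q (λ xs → R≗P∧Q (true ∷ xs)))
                 (#sat-∧-++ m n _ Q (λ xs → R≗P∧Q (false ∷ xs))) ⟩
  #sat m (λ v → P (true ∷ v)) * #sat n Q + #sat m (λ v → P (false ∷ v)) * #sat n Q
    ≡⟨ sym (*-distribʳ-+ (#sat n Q) (#sat m (λ v → P (true ∷ v))) (#sat m (λ v → P (false ∷ v)))) ⟩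
  #sat (suc m) P * #sat n Q ∎

#sat+#sat∘not≡2^n : ∀ n (P : Vec Bool n → Bool) → #sat n P + #sat n (λ v → not (P v)) ≡ 2 ^ n
#sat+#sat∘not≡2^n zero P with P []
... | true  = refl
... | false = refl
#sat+#sat∘not≡2^n (suc n) P = begin
  (#sat n P₁ + #sat n P₀) + (#sat n (λ v → not (P₁ v)) + #sat n (λ v → not (P₀ v)))
    ≡⟨ interchange (#sat n P₁) (#sat n P₀) _ _ ⟩
  (#sat n P₁ + #sat n (λ v → not (P₁ v))) + (#sat n P₀ + #sat n (λ v → not (P₀ v)))
    ≡⟨ cong₂ _+_ (#sat+#sat∘not≡2^n n P₁) (#sat+#sat∘not≡2^n n P₀) ⟩
  2 ^ n + 2 ^ n
    ≡⟨ cong (2 ^ n +_) (sym (+-identityʳ (2 ^ n))) ⟩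
  2 ^ suc n ∎
  where
  P₁ P₀ : Vec Bool n → Bool
  P₁ v = P (true ∷ v)
  P₀ v = P (false ∷ v)

parity-#sat≡parity-#sat∘not : ∀ n (P : Vec Bool (suc n) → Bool) →
                              parity (#sat (suc n) P) ≡ parity (#sat (suc n) (λ v → not (P v)))
parity-#sat≡parity-#sat∘not n P = x+y≡0ℙ⇒x≡y (begin
  parity (#sat (suc n) P) ℙ.+ parity (#sat (suc n) (λ v → not (P v)))
    ≡⟨ sym (+-homo-+ (#sat (suc n) P) _) ⟩
  parity (#sat (suc n) P + #sat (suc n) (λ v → not (P v)))
    ≡⟨ cong parity (#sat+#sat∘not≡2^n (suc n) P) ⟩
  parity (2 * 2 ^ n)
    ≡⟨ *-homo-* 2 (2 ^ n) ⟩
  0ℙ ∎)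

length-filter-map : ∀ (P : B → Bool) (f : A → B) xs →
                    length (filter (λ x → T? (P x)) (map f xs)) ≡ length (filter (λ x → T? (P (f x))) xs)
length-filter-map P f []       = refl
length-filter-map P f (x ∷ xs) with P (f x)
... | true  = cong suc (length-filter-map P f xs)
... | false = length-filter-map P f xs

length-filter-vals : ∀ n (P : Vec Bool n → Bool) → length (filter (λ v → T? (P v)) (vals n)) ≡ #sat n P
length-filter-vals zero P with P []
... | true  = refl
... | false = refl
length-filter-vals (suc n) P = begin
  length (filter P? (map (true ∷_) (vals n) ++ map (false ∷_) (vals n)))
    ≡⟨ cong length (filter-++ P? (map (true ∷_) (vals n)) (map (false ∷_) (vals n))) ⟩
  length (filter P? (map (true ∷_) (vals n)) ++ filter P? (map (false ∷_) (vals n)))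
    ≡⟨ length-++ (filter P? (map (true ∷_) (vals n))) ⟩
  length (filter P? (map (true ∷_) (vals n))) + length (filter P? (map (false ∷_) (vals n)))
    ≡⟨ cong₂ _+_ (trans (length-filter-map P (true ∷_) (vals n)) (length-filter-vals n _))
                 (trans (length-filter-map P (false ∷_) (vals n)) (length-filter-vals n _)) ⟩
  #sat (suc n) P ∎
  where
  P? : (v : Vec Bool (suc n)) → Dec (T (P v))
  P? v = T? (P v)

zeros≡#sat : ∀ {n} (φ : Br n) → zeros φ ≡ #sat n (λ v → not (eval φ v))
zeros≡#sat {n} φ = length-filter-vals n (λ v → not (eval φ v))

splitAt-++ : ∀ m {n} (xs : Vec A m) (ys : Vec A n) → splitAt m (xs ++ᵥ ys) ≡ (xs , ys , refl)
splitAt-++ zero    []       ys = refl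
splitAt-++ (suc m) (x ∷ xs) ys rewrite splitAt-++ m xs ys = refl

eval-impl-++ : ∀ {m k} (l : Br (suc m)) (r : Br (suc k)) xs ys →
               eval (impl l r) (xs ++ᵥ ys) ≡ eval l xs ⇀ eval r ys
eval-impl-++ {m} l r xs ys rewrite splitAt-++ (suc m) xs ys = refl

parity-zeros : ∀ {n} (φ : Br n) → parity (zeros φ) ≡ 1ℙ
parity-zeros var = refl
parity-zeros (impl {m} {k} l r) = begin
  parity (zeros (impl l r))
    ≡⟨ cong parity (zeros≡#sat (impl l r)) ⟩
  parity (#sat (suc m + suc k) (λ v → not (eval (impl l r) v)))
    ≡⟨ cong parity (#sat-∧-++ (suc m) (suc k) {R} (eval l) (eval r) zeros-of-impl) ⟩
  parity (#sat (suc m) (eval l) * #sat (suc k) (eval r))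
    ≡⟨ *-homo-* (#sat (suc m) (eval l)) (#sat (suc k) (eval r)) ⟩
  parity (#sat (suc m) (eval l)) ℙ.* parity (#sat (suc k) (eval r))
    ≡⟨ cong₂ ℙ._*_ (parity-ones l) (parity-ones r) ⟩
  1ℙ ∎
  where
  R : Vec Bool (suc m + suc k) → Bool
  R v = not (eval (impl l r) v)

  zeros-of-impl : ∀ xs ys → R (xs ++ᵥ ys) ≡ eval l xs ∧ eval r ys
  zeros-of-impl xs ys = trans (cong not (eval-impl-++ l r xs ys)) (not-involutive _)

  parity-ones : ∀ {j} (ψ : Br (suc j)) → parity (#sat (suc j) (eval ψ)) ≡ 1ℙ
  parity-ones {j} ψ = trans (parity-#sat≡parity-#sat∘not j (eval ψ))
                            (trans (cong parity (sym (zeros≡#sat ψ))) (parity-zeros ψ))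

-- Counting bracketings modulo 2

δ : ℕ → ℕ → ℕ
δ m n = if does (m ≟ n) then 1 else 0

δ-double : ∀ s j → δ (s + s) (j + j) ≡ δ s j
δ-double zero    zero    = refl
δ-double zero    (suc j) = refl
δ-double (suc s) zero    = refl
δ-double (suc s) (suc j) rewrite +-suc s s | +-suc j j = δ-double s j

δ-double-odd : ∀ s j → δ (s + s) (suc (j + j)) ≡ 0
δ-double-odd zero    j       = refl
δ-double-odd (suc s) zero    rewrite +-suc s s = refl
δ-double-odd (suc s) (suc j) rewrite +-suc s s | +-suc j j = δ-double-odd s j

#ofSize : ℕ → List (Σ ℕ Br) → ℕ
#ofSize n ts = ∑ ts (λ t → δ (proj₁ t) n)

-- The selector used by bracketings is local to its where-block; unification recovers it.
bracketings-selector : ∀ n → Σ (Σ ℕ Br → List (Br n)) λ select →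
                       bracketings n ≡ concatMap select (depthUpTo n)
bracketings-selector n = _ , refl

length-bracketings : ∀ n → length (bracketings n) ≡ #ofSize n (depthUpTo n)
length-bracketings n =
  trans (length-concatMap select (depthUpTo n)) (∑-cong (depthUpTo n) length-select)
  where
  select : Σ ℕ Br → List (Br n)
  select = proj₁ (bracketings-selector n)

  length-select : ∀ t → length (select t) ≡ δ (proj₁ t) n
  length-select (k , t) with k ≟ n
  ... | yes refl = cong (λ b → if b then 1 else 0) (sym (dec-true (n ≟ n) refl))
  ... | no k≢n   = cong (λ b → if b then 1 else 0) (sym (dec-false (k ≟ n) k≢n))

#ofSize-depthUpTo-suc : ∀ d n →
  #ofSize n (depthUpTo (suc d)) ≡
  δ 1 n + ∑ (depthUpTo d) (λ l → ∑ (depthUpTo d) (λ r → δ (proj₁ l + proj₁ r) n))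
#ofSize-depthUpTo-suc d n = cong (δ 1 n +_) (trans (∑-concatMap _ (depthUpTo d) _)
  (∑-cong (depthUpTo d) λ
    { (zero , ())
    ; (suc m , l) → trans (∑-concatMap _ (depthUpTo d) _)
                          (∑-cong (depthUpTo d) λ { (zero , ()) ; (suc k , r) → +-identityʳ _ }) }))

parity-#ofSize-depthUpTo-suc : ∀ d n →
  parity (#ofSize n (depthUpTo (suc d))) ≡
  parity (δ 1 n) ℙ.+ parity (∑ (depthUpTo d) (λ t → δ (proj₁ t + proj₁ t) n))
parity-#ofSize-depthUpTo-suc d n = begin
  parity (#ofSize n (depthUpTo (suc d)))
    ≡⟨ cong parity (#ofSize-depthUpTo-suc d n) ⟩
  parity (δ 1 n + ∑ D (λ l → ∑ D (λ r → δ (proj₁ l + proj₁ r) n)))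
    ≡⟨ +-homo-+ (δ 1 n) _ ⟩
  parity (δ 1 n) ℙ.+ parity (∑ D (λ l → ∑ D (λ r → δ (proj₁ l + proj₁ r) n)))
    ≡⟨ cong (parity (δ 1 n) ℙ.+_) (parity-∑∑-symmetric D (λ l r → δ (proj₁ l + proj₁ r) n)
                                     (λ l r → cong (λ s → δ s n) (+-comm (proj₁ l) (proj₁ r)))) ⟩
  parity (δ 1 n) ℙ.+ parity (∑ D (λ t → δ (proj₁ t + proj₁ t) n)) ∎
  where
  D : List (Σ ℕ Br)
  D = depthUpTo d

parity-#ofSize-odd : ∀ d j →
  parity (#ofSize (suc (j + j)) (depthUpTo (suc d))) ≡ parity (δ 1 (suc (j + j)))
parity-#ofSize-odd d j = begin
  parity (#ofSize (suc (j + j)) (depthUpTo (suc d)))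
    ≡⟨ parity-#ofSize-depthUpTo-suc d (suc (j + j)) ⟩
  parity (δ 1 (suc (j + j))) ℙ.+ parity (∑ (depthUpTo d) (λ t → δ (proj₁ t + proj₁ t) (suc (j + j))))
    ≡⟨ cong (λ s → parity (δ 1 (suc (j + j))) ℙ.+ parity s)
            (trans (∑-cong (depthUpTo d) (λ t → δ-double-odd (proj₁ t) j)) (∑-zero (depthUpTo d))) ⟩
  parity (δ 1 (suc (j + j))) ℙ.+ 0ℙ
    ≡⟨ ℙₚ.+-identityʳ _ ⟩
  parity (δ 1 (suc (j + j))) ∎

2+[n+n]≡[1+n]+[1+n] : ∀ n → suc (suc (n + n)) ≡ suc n + suc n
2+[n+n]≡[1+n]+[1+n] n = cong suc (sym (+-suc n n))

parity-#ofSize-even : ∀ d j →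
  parity (#ofSize (suc (suc (j + j))) (depthUpTo (suc d))) ≡ parity (#ofSize (suc j) (depthUpTo d))
parity-#ofSize-even d j =
  trans (parity-#ofSize-depthUpTo-suc d (suc (suc (j + j))))
        (cong parity (∑-cong (depthUpTo d) diagonal))
  where
  diagonal : ∀ t → δ (proj₁ t + proj₁ t) (suc (suc (j + j))) ≡ δ (proj₁ t) (suc j)
  diagonal (s , _) = trans (cong (δ (s + s)) (2+[n+n]≡[1+n]+[1+n] j)) (δ-double s (suc j))

-- Binomial coefficients modulo 2

pascal : ∀ n k → n C k + n C suc k ≡ suc n C suc k
pascal = nCk+nC[k+1]≡[n+1]C[k+1]

parity-[2+n]C[2+k] : ∀ n k → parity (suc (suc n) C suc (suc k)) ≡ parity (n C k) ℙ.+ parity (n C suc (suc k))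
parity-[2+n]C[2+k] n k = begin
  parity (suc (suc n) C suc (suc k))
    ≡⟨ cong parity (sym (trans (cong₂ _+_ (pascal n k) (pascal n (suc k))) (pascal (suc n) (suc k)))) ⟩
  parity ((n C k + n C suc k) + (n C suc k + n C suc (suc k)))
    ≡⟨ parity[[a+b]+[b+c]] (n C k) (n C suc k) (n C suc (suc k)) ⟩
  parity (n C k) ℙ.+ parity (n C suc (suc k)) ∎

parity-[a+a]C[b+b] : ∀ a b → parity ((a + a) C (b + b)) ≡ parity (a C b)
parity-[a+a]C[b+b] zero    zero    = refl
parity-[a+a]C[b+b] zero    (suc b) = refl
parity-[a+a]C[b+b] (suc a) zero    = refl
parity-[a+a]C[b+b] (suc a) (suc b) = begin
  parity ((suc a + suc a) C (suc b + suc b))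
    ≡⟨ cong₂ (λ x y → parity (x C y)) (sym (2+[n+n]≡[1+n]+[1+n] a)) (sym (2+[n+n]≡[1+n]+[1+n] b)) ⟩
  parity (suc (suc (a + a)) C suc (suc (b + b)))
    ≡⟨ parity-[2+n]C[2+k] (a + a) (b + b) ⟩
  parity ((a + a) C (b + b)) ℙ.+ parity ((a + a) C suc (suc (b + b)))
    ≡⟨ cong (λ y → parity ((a + a) C (b + b)) ℙ.+ parity ((a + a) C y)) (2+[n+n]≡[1+n]+[1+n] b) ⟩
  parity ((a + a) C (b + b)) ℙ.+ parity ((a + a) C (suc b + suc b))
    ≡⟨ cong₂ ℙ._+_ (parity-[a+a]C[b+b] a b) (parity-[a+a]C[b+b] a (suc b)) ⟩
  parity (a C b) ℙ.+ parity (a C suc b)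
    ≡⟨ sym (+-homo-+ (a C b) (a C suc b)) ⟩
  parity (a C b + a C suc b)
    ≡⟨ cong parity (pascal a b) ⟩
  parity (suc a C suc b) ∎

parity-[a+a]C[1+b+b] : ∀ a b → parity ((a + a) C suc (b + b)) ≡ 0ℙ
parity-[a+a]C[1+b+b] zero    b       = refl
parity-[a+a]C[1+b+b] (suc a) zero    = trans (cong parity (nC1≡n (suc a + suc a))) (parity[m+m]≡0ℙ (suc a))
parity-[a+a]C[1+b+b] (suc a) (suc b) = begin
  parity ((suc a + suc a) C suc (suc b + suc b))
    ≡⟨ cong₂ (λ x y → parity (x C suc y)) (sym (2+[n+n]≡[1+n]+[1+n] a)) (sym (2+[n+n]≡[1+n]+[1+n] b)) ⟩
  parity (suc (suc (a + a)) C suc (suc (suc (b + b))))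
    ≡⟨ parity-[2+n]C[2+k] (a + a) (suc (b + b)) ⟩
  parity ((a + a) C suc (b + b)) ℙ.+ parity ((a + a) C suc (suc (suc (b + b))))
    ≡⟨ cong (λ y → parity ((a + a) C suc (b + b)) ℙ.+ parity ((a + a) C suc y)) (2+[n+n]≡[1+n]+[1+n] b) ⟩
  parity ((a + a) C suc (b + b)) ℙ.+ parity ((a + a) C suc (suc b + suc b))
    ≡⟨ cong₂ ℙ._+_ (parity-[a+a]C[1+b+b] a b) (parity-[a+a]C[1+b+b] a (suc b)) ⟩
  0ℙ ∎

parity-[2+2n]C[1+n] : ∀ n → parity ((suc n + suc n) C suc n) ≡ 0ℙ
parity-[2+2n]C[1+n] n = begin
  parity (suc (n + suc n) C suc n)
    ≡⟨ cong parity (sym (pascal (n + suc n) n)) ⟩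
  parity ((n + suc n) C n + (n + suc n) C suc n)
    ≡⟨ cong (λ x → parity ((n + suc n) C n + x)) symmetry ⟩
  parity ((n + suc n) C n + (n + suc n) C n)
    ≡⟨ parity[m+m]≡0ℙ ((n + suc n) C n) ⟩
  0ℙ ∎
  where
  symmetry : (n + suc n) C suc n ≡ (n + suc n) C n
  symmetry = trans (nCk≡nC[n∸k] (m≤n+m (suc n) n)) (cong ((n + suc n) C_) (m+n∸n≡m n (suc n)))

-- Catalan numbers modulo 2

[k+1]*[n+1]C[k+1]≡[n+1]*nCk : ∀ n k → suc k * (suc n C suc k) ≡ suc n * (n C k)
[k+1]*[n+1]C[k+1]≡[n+1]*nCk zero    zero    = refl
[k+1]*[n+1]C[k+1]≡[n+1]*nCk zero    (suc k) = *-zeroʳ (suc (suc k))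
[k+1]*[n+1]C[k+1]≡[n+1]*nCk (suc n) zero    =
  trans (+-identityʳ _) (trans (nC1≡n (suc (suc n))) (sym (*-identityʳ (suc (suc n)))))
[k+1]*[n+1]C[k+1]≡[n+1]*nCk (suc n) (suc k) = begin
  suc (suc k) * (suc (suc n) C suc (suc k))
    ≡⟨ cong (suc (suc k) *_) (sym (pascal (suc n) (suc k))) ⟩
  suc (suc k) * (Z + W)
    ≡⟨ *-distribˡ-+ (suc (suc k)) Z W ⟩
  (Z + suc k * Z) + suc (suc k) * W
    ≡⟨ cong₂ (λ u v → (Z + u) + v) ([k+1]*[n+1]C[k+1]≡[n+1]*nCk n k) ([k+1]*[n+1]C[k+1]≡[n+1]*nCk n (suc k)) ⟩
  (Z + suc n * (n C k)) + suc n * (n C suc k)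
    ≡⟨ +-assoc Z _ _ ⟩
  Z + (suc n * (n C k) + suc n * (n C suc k))
    ≡⟨ cong (Z +_) (sym (*-distribˡ-+ (suc n) (n C k) (n C suc k))) ⟩
  Z + suc n * (n C k + n C suc k)
    ≡⟨ cong (λ u → Z + suc n * u) (pascal n k) ⟩
  Z + suc n * Z ∎
  where
  Z W : ℕ
  Z = suc n C suc k
  W = suc n C suc (suc k)

module _ (m : ℕ) where

  private
    a b : ℕ
    a = (m + m) C m
    b = (m + m) C suc m

  [m+1]*[2m]C[m+1]≡m*[2m]Cm : suc m * b ≡ m * a
  [m+1]*[2m]C[m+1]≡m*[2m]Cm = +-cancelˡ-≡ (suc m * a) (suc m * b) (m * a) (begin
    suc m * a + suc m * b         ≡⟨ sym (*-distribˡ-+ (suc m) a b) ⟩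
    suc m * (a + b)               ≡⟨ cong (suc m *_) (pascal (m + m) m) ⟩
    suc m * (suc (m + m) C suc m) ≡⟨ [k+1]*[n+1]C[k+1]≡[n+1]*nCk (m + m) m ⟩
    a + (m + m) * a               ≡⟨ cong (a +_) (*-distribʳ-+ a m m) ⟩
    a + (m * a + m * a)           ≡⟨ sym (+-assoc a (m * a) (m * a)) ⟩
    suc m * a + m * a             ∎)

  [2m]C[m+1]≤[2m]Cm : b ≤ a
  [2m]C[m+1]≤[2m]Cm =
    *-cancelˡ-≤ (suc m) (subst (_≤ suc m * a) (sym [m+1]*[2m]C[m+1]≡m*[2m]Cm) (m≤n+m (m * a) a))

  catalan-suc : catalan (suc m) ≡ a ∸ b
  catalan-suc = begin
    ((2 * suc m ∸ 2) C m) / suc m ≡⟨ cong (λ n → (n C m) / suc m) 2[m+1]∸2≡m+m ⟩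
    a / suc m                     ≡⟨ cong (_/ suc m) a≡[a∸b]*[m+1] ⟩
    (a ∸ b) * suc m / suc m       ≡⟨ m*n/n≡m (a ∸ b) (suc m) ⟩
    a ∸ b                         ∎
    where
    2[m+1]∸2≡m+m : 2 * suc m ∸ 2 ≡ m + m
    2[m+1]∸2≡m+m = cong (_∸ 2) (trans (cong (suc m +_) (+-identityʳ (suc m))) (cong suc (+-suc m m)))

    a≡[a∸b]*[m+1] : a ≡ (a ∸ b) * suc m
    a≡[a∸b]*[m+1] = sym (begin
      (a ∸ b) * suc m       ≡⟨ *-distribʳ-∸ (suc m) a b ⟩
      a * suc m ∸ b * suc m ≡⟨ cong₂ _∸_ (*-comm a (suc m)) (trans (*-comm b (suc m)) [m+1]*[2m]C[m+1]≡m*[2m]Cm) ⟩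
      (a + m * a) ∸ m * a   ≡⟨ m+n∸n≡m a (m * a) ⟩
      a                     ∎)

  parity-catalan-suc : parity (catalan (suc m)) ≡ parity a ℙ.+ parity b
  parity-catalan-suc = trans (cong parity catalan-suc) (parity-∸ [2m]C[m+1]≤[2m]Cm)

parity-catalan-even : ∀ j → parity (catalan (suc (suc (j + j)))) ≡ parity (catalan (suc j))
parity-catalan-even j = begin
  parity (catalan (suc m))
    ≡⟨ parity-catalan-suc m ⟩
  parity ((m + m) C m) ℙ.+ parity ((m + m) C suc m)
    ≡⟨ cong₂ ℙ._+_ (parity-[a+a]C[1+b+b] m j)
                   (trans (cong (λ k → parity ((m + m) C k)) (2+[n+n]≡[1+n]+[1+n] j))
                          (parity-[a+a]C[b+b] m (suc j))) ⟩
  parity (m C suc j)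
    ≡⟨ cong parity (sym (pascal (j + j) j)) ⟩
  parity ((j + j) C j + (j + j) C suc j)
    ≡⟨ +-homo-+ ((j + j) C j) ((j + j) C suc j) ⟩
  parity ((j + j) C j) ℙ.+ parity ((j + j) C suc j)
    ≡⟨ sym (parity-catalan-suc j) ⟩
  parity (catalan (suc j)) ∎
  where
  m : ℕ
  m = suc (j + j)

parity-catalan-odd : ∀ i → parity (catalan (suc (suc i + suc i))) ≡ 0ℙ
parity-catalan-odd i = begin
  parity (catalan (suc m))
    ≡⟨ parity-catalan-suc m ⟩
  parity ((m + m) C m) ℙ.+ parity ((m + m) C suc m)
    ≡⟨ cong₂ ℙ._+_ (trans (parity-[a+a]C[b+b] m (suc i)) (parity-[2+2n]C[1+n] i))
                   (parity-[a+a]C[1+b+b] m (suc i)) ⟩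
  0ℙ ∎
  where
  m : ℕ
  m = suc i + suc i

data Halving : ℕ → Set where
  even : ∀ j → Halving (j + j)
  odd  : ∀ j → Halving (suc (j + j))

halving : ∀ n → Halving n
halving zero = even 0
halving (suc n) with halving n
... | even j = odd j
... | odd j  = subst Halving (sym (2+[n+n]≡[1+n]+[1+n] j)) (even (suc j))

parity-#ofSize≡parity-catalan : ∀ d m → m ≤ d →
  parity (#ofSize (suc m) (depthUpTo d)) ≡ parity (catalan (suc m))
parity-#ofSize≡parity-catalan zero zero _ = refl
parity-#ofSize≡parity-catalan (suc d) m _ with halving m
parity-#ofSize≡parity-catalan (suc d) .(zero + zero) _ | even zero = parity-#ofSize-odd d 0
parity-#ofSize≡parity-catalan (suc d) .(suc i + suc i) _ | even (suc i) =
  trans (parity-#ofSize-odd d (suc i)) (sym (parity-catalan-odd i))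
parity-#ofSize≡parity-catalan (suc d) .(suc (j + j)) (s≤s j+j≤d) | odd j = begin
  parity (#ofSize (suc (suc (j + j))) (depthUpTo (suc d))) ≡⟨ parity-#ofSize-even d j ⟩
  parity (#ofSize (suc j) (depthUpTo d))                   ≡⟨ parity-#ofSize≡parity-catalan d j (≤-trans (m≤m+n j j) j+j≤d) ⟩
  parity (catalan (suc j))                                 ≡⟨ sym (parity-catalan-even j) ⟩
  parity (catalan (suc (suc (j + j))))                     ∎

theorem4p2 : (n : ℕ) → y (suc n) % 2 ≡ catalan (suc n) % 2
theorem4p2 n = begin
  y (suc n) % 2                  ≡⟨ n%2≡toℕ[parity[n]] (y (suc n)) ⟩
  toℕ (parity (y (suc n)))       ≡⟨ cong toℕ parity-y ⟩
  toℕ (parity (catalan (suc n))) ≡⟨ sym (n%2≡toℕ[parity[n]] (catalan (suc n))) ⟩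
  catalan (suc n) % 2            ∎
  where
  parity-y : parity (y (suc n)) ≡ parity (catalan (suc n))
  parity-y = begin
    parity (y (suc n))                                   ≡⟨ parity-∑-odd (bracketings (suc n)) zeros parity-zeros ⟩
    parity (length (bracketings (suc n)))                ≡⟨ cong parity (length-bracketings (suc n)) ⟩
    parity (#ofSize (suc n) (depthUpTo (suc n)))         ≡⟨ parity-#ofSize≡parity-catalan (suc n) n (n≤1+n n) ⟩
    parity (catalan (suc n))                             ∎
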